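{- Let $p\ge2$ be an integer, let $f\in\mathcal{R}$ satisfy $U_pf=\lambda f$ with $\lambda\neq0$, and suppose $f(x)=x^m\tilde f(x)$ for some positive integer $m$ and some $\tilde f$ with $\tilde f(0)\neq0$. Then $p\nmid m$.
   Context: $\mathcal{R}$ denotes the real vector space of rational functions $f(x)=A(x)/B(x)$ with real coefficients, $\deg A<\deg B$ and $B(0)\neq 0$, identified with their Taylor series at $0$. For a positive integer $p$, $U_p\big(\sum_{n\ge0}a_nx^n\big)=\sum_{n\ge0}a_{pn}x^n$. -}

module Defs where

open import Level using (Level; _⊔_)
open import Data.Nat using (ℕ; zero; suc; _≤_; _<_; _∸_; _*_)
open import Data.Product using (Σ; ∃; _×_)
open import Relation.Nullary using (¬_)
open import Algebra.Bundles using (CommutativeRing)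

module _ {c ℓ : Level} (R : CommutativeRing c ℓ) where
  open CommutativeRing R using (_≈_; _+_; 0#; 1#) renaming (Carrier to K; _*_ to _·_)

  IsField : Set (c ⊔ ℓ)
  IsField = (¬ (1# ≈ 0#)) × (∀ x → ¬ (x ≈ 0#) → ∃ λ y → (x · y) ≈ 1#)

  Series : Set c
  Series = ℕ → K

  sumTo : ℕ → (ℕ → K) → K
  sumTo zero    g = g zero
  sumTo (suc n) g = sumTo n g + g (suc n)

  conv : Series → Series → Series
  conv B f n = sumTo n (λ i → B i · f (n ∸ i))

  -- f is (the Taylor series at 0 of) A/B with A, B polynomials,
  -- deg A < deg B and B(0) ≠ 0.  B has degree exactly e (B_e ≠ 0,
  -- B_n = 0 for n > e); deg A < e means A_n = 0 for all n ≥ e.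
  IsRational : Series → Set (c ⊔ ℓ)
  IsRational f =
    Σ ℕ λ e → Σ Series λ A → Σ Series λ B →
      (¬ (B e ≈ 0#)) × (∀ n → e < n → B n ≈ 0#) ×
      (∀ n → e ≤ n → A n ≈ 0#) ×
      (¬ (B 0 ≈ 0#)) ×
      (∀ n → conv B f n ≈ A n)

  U : ℕ → Series → Series
  U p f n = f (p * n)

  -- f = x^m · g  (coefficientwise)
  IsShift : ℕ → Series → Series → Set ℓ
  IsShift m f g = (∀ n → n < m → f n ≈ 0#) × (∀ n → f (m Data.Nat.+ n) ≈ g n)

{-# OPTIONS --safe #-}
module Submission where

-- If p ∣ m, say m = p q, then the eigen-equation gives a_m = a_{pq} = λ a_q,
-- and a_q = 0 because q < m; this contradicts a_m = g(0) ≠ 0.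

open import Defs
open import Level using (Level)
open import Data.Nat using (ℕ; _≤_; _<_; _*_; >-nonZero; n>1⇒nonTrivial)
open import Data.Nat.Divisibility using (_∣_; quotient; quotient-<; m∣n⇒n≡m*quotient)
open import Data.Nat.Properties using (+-identityʳ)
open import Data.Product using (_,_)
open import Relation.Nullary using (¬_)
open import Relation.Binary.PropositionalEquality as ≡ using ()
open import Algebra.Bundles using (CommutativeRing)

module _ {c ℓ : Level} (R : CommutativeRing c ℓ) where
  open CommutativeRing R using (_≈_; 0#; sym; trans; reflexive; *-congˡ; zeroʳ)
    renaming (_*_ to _·_)

  U-eigen-preserves-zero : ∀ p {λ₀} {f : Series R} → (∀ n → U R p f n ≈ λ₀ · f n) →
                           ∀ {n} → f n ≈ 0# → f (p * n) ≈ 0#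
  U-eigen-preserves-zero p {λ₀} eigen {n} fn≈0 =
    trans (eigen n) (trans (*-congˡ fn≈0) (zeroʳ λ₀))

  IsShift⇒head≈coeff : ∀ {m} {f g : Series R} → IsShift R m f g → g 0 ≈ f m
  IsShift⇒head≈coeff {m} {f} (_ , shift) =
    trans (sym (shift 0)) (reflexive (≡.cong f (+-identityʳ m)))

mainTheorem16 : {c ℓ : Level} (R : CommutativeRing c ℓ) → IsField R →
    (p : ℕ) → 2 ≤ p →
    (f : Series R) → IsRational R f →
    (λ₀ : CommutativeRing.Carrier R) → ¬ (CommutativeRing._≈_ R λ₀ (CommutativeRing.0# R)) →
    (∀ n → CommutativeRing._≈_ R (U R p f n) (CommutativeRing._*_ R λ₀ (f n))) →
    (m : ℕ) → 0 < m → (g : Series R) → IsShift R m f g →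
    ¬ (CommutativeRing._≈_ R (g 0) (CommutativeRing.0# R)) →
    ¬ (p ∣ m)
mainTheorem16 R _ p p≥2 f _ _ _ eigen m m>0 g shift@(belowM , _) g0≉0 p∣m =
  g0≉0 (trans (IsShift⇒head≈coeff R shift) fm≈0)
  where
  open CommutativeRing R using (_≈_; 0#; trans; reflexive)
  instance
    _ = n>1⇒nonTrivial p≥2
    _ = >-nonZero m>0
  fm≈0 : f m ≈ 0#
  fm≈0 = trans (reflexive (≡.cong f (m∣n⇒n≡m*quotient p∣m)))
               (U-eigen-preserves-zero R p eigen (belowM (quotient p∣m) (quotient-< p∣m)))
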